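{- Let $q \geq 4$ be a prime power, let $\mathbb{F}_q$ be the finite field with $q$ elements, let $l$ be a positive integer, and let $a_1, \dots, a_l$ be $l$ distinct elements of $\mathbb{F}_q$. Set $D := \mathbb{F}_q \setminus \{a_1, \dots, a_l\} = \{x_1, \dots, x_{q-l}\}$ and let $k$ be an integer with $2 \leq k \leq q-l-1$. For $1 \leq j \leq l$, define $$u_j(x) := \lambda_j (x-a_j)^{q-2} + r_j(x),$$ where $\lambda_j \in \mathbb{F}_q^*$ and $r_j(x) \in \mathbb{F}_q[x]$ is a polynomial of degree at most $k-1$. Then each of the received words $u_1(D), \dots, u_l(D)$ is a deep hole of the generalized Reed-Solomon code $\mathcal{C}_q(D,k)$, i.e. $d(u_j(D), \mathcal{C}_q(D,k)) = q-l-k$ for every $1 \le j \le l$.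
   Context: For $f(x) \in \mathbb{F}_q[x]$ and $D = \{x_1, \dots, x_{n}\} \subseteq \mathbb{F}_q$, write $f(D) := (f(x_1), \dots, f(x_{n})) \in \mathbb{F}_q^{n}$. The generalized Reed-Solomon code with evaluation set $D$ and dimension $k$ is $\mathcal{C}_q(D,k) := \{ f(D) : f(x) \in \mathbb{F}_q[x], \deg f \leq k-1\}$. The Hamming distance $d(u,v)$ between two words of $\mathbb{F}_q^{n}$ is the number of coordinates in which they differ; the error distance of a word $u$ to the code $\mathcal{C}$ is $d(u, \mathcal{C}) := \min\{ d(u,v) : v \in \mathcal{C}\}$. The covering radius of $\mathcal{C}_q(D,k)$ is $n-k$, and a word $u \in \mathbb{F}_q^{n}$ is called a deep hole of $\mathcal{C}_q(D,k)$ if $d(u, \mathcal{C}_q(D,k)) = n-k$ (here $n = q-l$). -}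

module Defs where

open import Level using (Level; _⊔_)
open import Algebra.Bundles using (CommutativeRing)
open import Data.Nat as ℕ using (ℕ; zero; suc)
open import Data.Fin using (Fin)
import Data.Fin.Properties as FinP
open import Data.List as List using (List; []; _∷_; length; filter)
open import Data.List.Relation.Unary.Any using (Any)
open import Data.List.Relation.Unary.AllPairs using (AllPairs)
open import Data.Vec using (Vec; []; _∷_)
open import Data.Product using (Σ; ∃; _×_; _,_; proj₁)
open import Data.Nat.Primality using (Prime)
open import Relation.Nullary using (¬_; Dec; yes; no; ¬?)

open import Relation.Binary using (Decidable)

record IsFiniteField {c ℓ : Level} (R : CommutativeRing c ℓ) : Set (c ⊔ ℓ) where
  open CommutativeRing R
  field
    _≟_      : Decidable _≈_
    1≉0      : ¬ (1# ≈ 0#)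
    inverse  : ∀ x → ¬ (x ≈ 0#) → Σ Carrier (λ y → (x * y) ≈ 1#)
    elems    : List Carrier
    complete : ∀ x → Any (x ≈_) elems
    distinct : AllPairs (λ x y → ¬ (x ≈ y)) elems

  order : ℕ
  order = length elems

module FieldDefs {c ℓ : Level} (R : CommutativeRing c ℓ) (F : IsFiniteField R) where
  open CommutativeRing R
  open IsFiniteField F

  pow : Carrier → ℕ → Carrier
  pow x zero    = 1#
  pow x (suc n) = x * pow x n

  -- a polynomial of degree ≤ k - 1 given by its k coefficients
  -- (c₀ , c₁ , … , c_{k-1}); evaluation by Horner's rule
  evalPoly : ∀ {k} → Vec Carrier k → Carrier → Carrier
  evalPoly []       x = 0#
  evalPoly (c ∷ cs) x = c + x * evalPoly cs x

  evalSet : ∀ {l} → (Fin l → Carrier) → List Carrier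
  evalSet a = filter (λ x → ¬? (FinP.any? (λ i → x ≟ a i))) elems

  word : (Carrier → Carrier) → List Carrier → List Carrier
  word f D = List.map f D

  hamming : List Carrier → List Carrier → ℕ
  hamming []       _        = 0
  hamming (_ ∷ _)  []       = 0
  hamming (x ∷ xs) (y ∷ ys) with x ≟ y
  ... | yes _ = hamming xs ys
  ... | no  _ = suc (hamming xs ys)

  -- GRS code C_q(D,k) = { f(D) : deg f ≤ k-1 }.
  -- d(u, C_q(D,k)) = e, i.e. e is the minimum of d(u,v) over codewords v.
  ErrorDistance : List Carrier → (k : ℕ) → List Carrier → ℕ → Set c
  ErrorDistance D k u e =
      (Σ (Vec Carrier k) (λ f → hamming u (word (evalPoly f) D) ≡ₙ e))
    × (∀ (f : Vec Carrier k) → e ℕ.≤ hamming u (word (evalPoly f) D))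
    where
      open import Relation.Binary.PropositionalEquality using () renaming (_≡_ to _≡ₙ_)

  DeepHole : List Carrier → (k : ℕ) → List Carrier → Set c
  DeepHole D k u = ErrorDistance D k u (length D ℕ.∸ k)

IsPrimePower : ℕ → Set
IsPrimePower q = ∃ λ p → ∃ λ m → Prime p × (1 ℕ.≤ m) × (q ≡ p ℕ.^ m)
  where open import Relation.Binary.PropositionalEquality using (_≡_)

{-# OPTIONS --safe #-}
-- For x ≠ b Fermat's little theorem gives (x − b)^(q−2) = (x − b)⁻¹, so a polynomial f of
-- degree < k agrees with u = λ (x − b)^(q−2) + r at x ∈ D exactly when x is a root of
-- λ + (x − b)(r − f). That polynomial has degree ≤ k and value λ ≠ 0 at b, so u and f agree
-- in at most k places: d(u, C) ≥ |D| − k. Conversely, scale a polynomial vanishing at k points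
-- of D to take the value λ at b and write it as λ + (x − b) Q; then f = r − Q agrees with u
-- at exactly those k points.
module Submission where

open import Defs
open import Level using (Level)
open import Algebra.Bundles using (CommutativeRing; CommutativeMonoid)
open import Data.Nat as ℕ using (ℕ; zero; suc; _≤_; _∸_; z≤n; s≤s)
open import Data.Nat.Properties
  using (≤-trans; ≤-antisym; ≤-reflexive; +-suc; suc-injective; +-∸-assoc; m+n∸m≡n; m+n∸n≡m; m∸n≤m; ∸-monoʳ-≤)
open import Data.Fin using (Fin)
import Data.Fin.Properties as FinP
open import Data.Product using (Σ; ∃; _×_; _,_; proj₁; proj₂)
open import Data.List using (List; []; _∷_; length; filter; foldr; map; tabulate)
open import Data.List.Properties
  using (length-removeAt′; length-map; length-tabulate; filter-some; filter-none; filter-accept)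
open import Data.List.Relation.Unary.All using (All; []; _∷_)
import Data.List.Relation.Unary.All as All
open import Data.List.Relation.Unary.Any using (here; there; index)
import Data.List.Relation.Unary.Any as Any
open import Data.List.Relation.Unary.AllPairs using ([]; _∷_)
import Data.List.Relation.Unary.AllPairs as AllPairs
import Data.List.Relation.Unary.AllPairs.Properties as AllPairs
open import Data.List.Membership.Setoid.Properties
  using (∈-resp-≈; All[≉]⇒∉; ∉⇒All[≉]; ∈-filter⁺; ∈-filter⁻; ∈-map⁻; ∈-tabulate⁺)
open import Data.Vec using (Vec; []; _∷_; zipWith)
import Data.Vec as Vec
open import Function.Bundles using (_⇔_; mk⇔; Equivalence)
open import Function.Properties.Equivalence using () renaming (trans to ⇔-trans; sym to ⇔-sym)
open import Relation.Binary.Bundles using (Setoid)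
open import Relation.Binary.PropositionalEquality as ≡ using (_≡_)
open import Relation.Nullary using (¬_; yes; no; contradiction)
open import Relation.Unary using (Pred; Decidable)
open import Relation.Unary.Properties using (∁?)
import Algebra.Properties.AbelianGroup as AbelianGroupProperties
import Algebra.Properties.CommutativeSemigroup as CommutativeSemigroupProperties
import Algebra.Properties.Group as GroupProperties
import Algebra.Properties.Ring as RingProperties
import Algebra.Solver.Ring.NaturalCoefficients.Default as NaturalSolver

module _ {a p} {A : Set a} {P : Pred A p} (P? : Decidable P) where

  length-filter+length-filter-∁ : ∀ xs →
    length (filter P? xs) ℕ.+ length (filter (∁? P?) xs) ≡ length xs
  length-filter+length-filter-∁ []       = ≡.refl
  length-filter+length-filter-∁ (x ∷ xs) with P? x
  ... | yes _ = ≡.cong suc (length-filter+length-filter-∁ xs)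
  ... | no  _ = ≡.trans (+-suc _ _) (≡.cong suc (length-filter+length-filter-∁ xs))

module _ {a p q} {A : Set a} {P : Pred A p} {Q : Pred A q}
         (P? : Decidable P) (Q? : Decidable Q) where

  filter-≐-on : ∀ {xs} → All (λ x → P x ⇔ Q x) xs → filter P? xs ≡ filter Q? xs
  filter-≐-on {[]}     []             = ≡.refl
  filter-≐-on {x ∷ xs} (P⇔Q ∷ P⇔Qs) with P? x | Q? x
  ... | yes _  | yes _  = ≡.cong (x ∷_) (filter-≐-on P⇔Qs)
  ... | yes px | no ¬qx = contradiction (Equivalence.to P⇔Q px) ¬qx
  ... | no ¬px | yes qx = contradiction (Equivalence.from P⇔Q qx) ¬px
  ... | no  _  | no  _  = filter-≐-on P⇔Qs

module _ {c ℓ} (S : Setoid c ℓ) where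
  open Setoid S
  open import Data.List.Membership.Setoid S using (_∈_; _─_)
  open import Data.List.Relation.Binary.Subset.Setoid S using (_⊆_)
  open import Data.List.Relation.Unary.Unique.Setoid S using (Unique)

  ∈-─ : ∀ {x y xs} (p : x ∈ xs) → y ∈ xs → ¬ y ≈ x → y ∈ xs ─ p
  ∈-─ (here x≈z) (here y≈z)  y≉x = contradiction (trans y≈z (sym x≈z)) y≉x
  ∈-─ (here _)   (there y∈)  _   = y∈
  ∈-─ (there _)  (here y≈z)  _   = here y≈z
  ∈-─ (there p)  (there y∈)  y≉x = there (∈-─ p y∈ y≉x)

  ⊆-─ : ∀ {x xs ys} → Unique (x ∷ xs) → x ∷ xs ⊆ ys → (p : x ∈ ys) → xs ⊆ ys ─ p
  ⊆-─ (x≉xs ∷ _) sub p z∈xs =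
    ∈-─ p (sub (there z∈xs)) (λ z≈x → All[≉]⇒∉ S x≉xs (∈-resp-≈ S z≈x z∈xs))

  unique-⊆⇒length≤ : ∀ {xs ys} → Unique xs → xs ⊆ ys → length xs ≤ length ys
  unique-⊆⇒length≤ {[]}          _            _   = z≤n
  unique-⊆⇒length≤ {x ∷ xs} {ys} u@(_ ∷ u′) sub =
    ≡.subst (suc (length xs) ≤_) (≡.sym (length-removeAt′ ys (index p)))
      (s≤s (unique-⊆⇒length≤ u′ (⊆-─ u sub p)))
    where p = sub (here refl)

module _ {c ℓ} (M : CommutativeMonoid c ℓ) where
  open CommutativeMonoid M
  open CommutativeSemigroupProperties commutativeSemigroup using (x∙yz≈y∙xz)
  open import Data.List.Membership.Setoid setoid using (_∈_; _─_)
  open import Data.List.Relation.Binary.Subset.Setoid setoid using (_⊆_)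
  open import Data.List.Relation.Unary.Unique.Setoid setoid using (Unique)

  foldr-─ : ∀ {x ys} (p : x ∈ ys) → foldr _∙_ ε ys ≈ x ∙ foldr _∙_ ε (ys ─ p)
  foldr-─     (here x≈y)    = ∙-congʳ (sym x≈y)
  foldr-─ {x} (there {y} p) = trans (∙-congˡ (foldr-─ p)) (x∙yz≈y∙xz y x _)

  foldr-unique-⊆ : ∀ {xs ys} → Unique xs → xs ⊆ ys → length xs ≡ length ys →
                   foldr _∙_ ε xs ≈ foldr _∙_ ε ys
  foldr-unique-⊆ {[]} {[]}    _ _ _ = refl
  foldr-unique-⊆ {[]} {_ ∷ _} _ _ ()
  foldr-unique-⊆ {x ∷ xs} {ys} u@(_ ∷ u′) sub |xs|≡|ys| =
    trans (∙-congˡ (foldr-unique-⊆ u′ (⊆-─ setoid u sub p) |xs|≡|ys─p|)) (sym (foldr-─ p))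
    where
      p = sub (here refl)
      |xs|≡|ys─p| = suc-injective (≡.trans |xs|≡|ys| (length-removeAt′ ys (index p)))

module FiniteField {c ℓ} (R : CommutativeRing c ℓ) (F : IsFiniteField R) where
  open CommutativeRing R hiding (zero)
  open IsFiniteField F
  open FieldDefs R F
  open GroupProperties +-group using (x∙y⁻¹≈ε⇒x≈y; x≈y⇒x∙y⁻¹≈ε; //-rightDividesˡ)
  open AbelianGroupProperties +-abelianGroup using (⁻¹-∙-comm; ⁻¹-anti-homo‿-)
  open RingProperties ring using (-‿distribʳ-*)
  open NaturalSolver commutativeSemiring using (solve; _:=_; _:+_; _:*_)
  open import Data.List.Membership.Setoid setoid using (_∈_; _∉_)
  open import Data.List.Relation.Unary.Unique.Setoid setoid using (Unique)
  open import Relation.Binary.Reasoning.Setoid setoid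

  *-cancelˡ : ∀ {x y z} → x ≉ 0# → x * y ≈ x * z → y ≈ z
  *-cancelˡ {x} {y} {z} x≉0 xy≈xz = begin
      y              ≈⟨ *-identityˡ y ⟨
      1# * y         ≈⟨ *-congʳ x⁻¹x≈1 ⟨
      (x⁻¹ * x) * y  ≈⟨ *-assoc x⁻¹ x y ⟩
      x⁻¹ * (x * y)  ≈⟨ *-congˡ xy≈xz ⟩
      x⁻¹ * (x * z)  ≈⟨ *-assoc x⁻¹ x z ⟨
      (x⁻¹ * x) * z  ≈⟨ *-congʳ x⁻¹x≈1 ⟩
      1# * z         ≈⟨ *-identityˡ z ⟩
      z              ∎
    where
      x⁻¹ = proj₁ (inverse x x≉0)
      x⁻¹x≈1 = trans (*-comm x⁻¹ x) (proj₂ (inverse x x≉0))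

  x*y≈0⇔y≈0 : ∀ {x y} → x ≉ 0# → (x * y ≈ 0#) ⇔ (y ≈ 0#)
  x*y≈0⇔y≈0 {x} x≉0 =
    mk⇔ (λ xy≈0 → *-cancelˡ x≉0 (trans xy≈0 (sym (zeroʳ x))))
        (λ y≈0 → trans (*-congˡ y≈0) (zeroʳ x))

  *-nonZero : ∀ {x y} → x ≉ 0# → y ≉ 0# → x * y ≉ 0#
  *-nonZero x≉0 y≉0 xy≈0 = y≉0 (Equivalence.to (x*y≈0⇔y≈0 x≉0) xy≈0)

  ∃-ratio : ∀ {x y} → x ≉ 0# → y ≉ 0# → ∃ λ s → s ≉ 0# × s * x ≈ y
  ∃-ratio {x} {y} x≉0 y≉0 = y * x⁻¹ , *-nonZero y≉0 x⁻¹≉0 , (begin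
      (y * x⁻¹) * x  ≈⟨ *-assoc y x⁻¹ x ⟩
      y * (x⁻¹ * x)  ≈⟨ *-congˡ (trans (*-comm x⁻¹ x) xx⁻¹≈1) ⟩
      y * 1#         ≈⟨ *-identityʳ y ⟩
      y              ∎)
    where
      x⁻¹ = proj₁ (inverse x x≉0)
      xx⁻¹≈1 = proj₂ (inverse x x≉0)
      x⁻¹≉0 : x⁻¹ ≉ 0#
      x⁻¹≉0 x⁻¹≈0 = 1≉0 (trans (sym xx⁻¹≈1) (trans (*-congˡ x⁻¹≈0) (zeroʳ x)))

  x-y≉0 : ∀ {x y} → x ≉ y → x - y ≉ 0#
  x-y≉0 {x} {y} x≉y x-y≈0 = x≉y (x∙y⁻¹≈ε⇒x≈y x y x-y≈0)

  ≈0-cong : ∀ {x y} → x ≈ y → (x ≈ 0#) ⇔ (y ≈ 0#)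
  ≈0-cong x≈y = mk⇔ (trans (sym x≈y)) (trans x≈y)

  ≈⇔-≈0 : ∀ {x y} → (x ≈ y) ⇔ (x - y ≈ 0#)
  ≈⇔-≈0 {x} {y} = mk⇔ x≈y⇒x∙y⁻¹≈ε (x∙y⁻¹≈ε⇒x≈y x y)

  nonzeros : List Carrier
  nonzeros = filter (∁? (_≟ 0#)) elems

  ≉0-resp-≈ : ∀ {x y} → x ≈ y → x ≉ 0# → y ≉ 0#
  ≉0-resp-≈ x≈y x≉0 y≈0 = x≉0 (trans x≈y y≈0)

  ∈-nonzeros : ∀ {x} → x ≉ 0# → x ∈ nonzeros
  ∈-nonzeros {x} = ∈-filter⁺ setoid (∁? (_≟ 0#)) ≉0-resp-≈ {xs = elems} (complete x)

  nonzeros-≉0 : ∀ {x} → x ∈ nonzeros → x ≉ 0#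
  nonzeros-≉0 x∈ = proj₂ (∈-filter⁻ setoid (∁? (_≟ 0#)) ≉0-resp-≈ {xs = elems} x∈)

  length-nonzeros : length nonzeros ≡ order ∸ 1
  length-nonzeros =
    ≡.trans (≡.sym (m+n∸m≡n 1 (length nonzeros)))
            (≡.cong (_∸ 1) (≡.trans (≡.cong (ℕ._+ length nonzeros) (≡.sym |zeros|≡1))
                                     (length-filter+length-filter-∁ (_≟ 0#) elems)))
    where
      unique-zeros : Unique (filter (_≟ 0#) elems)
      unique-zeros = AllPairs.filter⁺ (_≟ 0#) distinct
      zeros⊆[0] : ∀ {x} → x ∈ filter (_≟ 0#) elems → x ∈ 0# ∷ []
      zeros⊆[0] x∈ = here (proj₂ (∈-filter⁻ setoid (_≟ 0#) (λ x≈y x≈0 → trans (sym x≈y) x≈0) {xs = elems} x∈))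
      |zeros|≡1 : length (filter (_≟ 0#) elems) ≡ 1
      |zeros|≡1 = ≤-antisym (unique-⊆⇒length≤ setoid unique-zeros zeros⊆[0])
                            (filter-some (_≟ 0#) (Any.map sym (complete 0#)))

  foldr-*-≉0 : ∀ xs → (∀ {x} → x ∈ xs → x ≉ 0#) → foldr _*_ 1# xs ≉ 0#
  foldr-*-≉0 []       _    = 1≉0
  foldr-*-≉0 (x ∷ xs) xs≉0 = *-nonZero (xs≉0 (here refl)) (foldr-*-≉0 xs (λ x∈ → xs≉0 (there x∈)))

  foldr-*-map-* : ∀ y xs → foldr _*_ 1# (map (y *_) xs) ≈ pow y (length xs) * foldr _*_ 1# xs
  foldr-*-map-* y []       = sym (*-identityˡ 1#)
  foldr-*-map-* y (x ∷ xs) = trans (*-congˡ (foldr-*-map-* y xs)) (interchange y x _ _)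
    where
      interchange : ∀ y x p q → (y * x) * (p * q) ≈ (y * p) * (x * q)
      interchange = solve 4 (λ y x p q → (y :* x) :* (p :* q) := (y :* p) :* (x :* q)) refl

  -- Multiplication by y permutes the nonzero elements, so it leaves their product unchanged.
  pow-length-nonzeros : ∀ {y} → y ≉ 0# → pow y (length nonzeros) ≈ 1#
  pow-length-nonzeros {y} y≉0 = *-cancelˡ Π≉0 (begin
      Π * pow y (length nonzeros)                   ≈⟨ *-comm Π _ ⟩
      pow y (length nonzeros) * Π                   ≈⟨ foldr-*-map-* y nonzeros ⟨
      foldr _*_ 1# (map (y *_) nonzeros)            ≈⟨ foldr-unique-⊆ *-commutativeMonoid unique-scaled scaled⊆ (length-map _ nonzeros) ⟩
      Π                                             ≈⟨ *-identityʳ Π ⟨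
      Π * 1#                                        ∎)
    where
      Π = foldr _*_ 1# nonzeros
      Π≉0 : Π ≉ 0#
      Π≉0 = foldr-*-≉0 nonzeros nonzeros-≉0
      unique-scaled : Unique (map (y *_) nonzeros)
      unique-scaled = AllPairs.map⁺ (AllPairs.map (λ x≉z yx≈yz → x≉z (*-cancelˡ y≉0 yx≈yz))
                                                  (AllPairs.filter⁺ _ distinct))
      scaled⊆ : ∀ {z} → z ∈ map (y *_) nonzeros → z ∈ nonzeros
      scaled⊆ z∈ with ∈-map⁻ setoid setoid z∈
      ... | x , x∈ , z≈yx = ∈-nonzeros (≉0-resp-≈ (sym z≈yx) (*-nonZero y≉0 (nonzeros-≉0 x∈)))

  fermat : ∀ {y} → 2 ≤ order → y ≉ 0# → y * pow y (order ∸ 2) ≈ 1#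
  fermat {y} 2≤q y≉0 =
    ≡.subst (λ n → pow y n ≈ 1#) (≡.trans length-nonzeros (+-∸-assoc 1 2≤q)) (pow-length-nonzeros y≉0)

  x+y*0≈x : ∀ x y → x + y * 0# ≈ x
  x+y*0≈x x y = trans (+-congˡ (zeroʳ y)) (+-identityʳ x)

  -- p = e + X p′ and p′ = p′(b) + (X − b) q′ give p = p(b) + (X − b)(p′(b) + X q′).
  quotient : ∀ {m} → Vec Carrier (suc m) → Carrier → Vec Carrier m
  quotient (_ ∷ [])        b = []
  quotient (_ ∷ p@(_ ∷ _)) b = evalPoly p b ∷ quotient p b

  evalPoly-quotient : ∀ {m} (p : Vec Carrier (suc m)) b x →
    evalPoly p x ≈ evalPoly p b + (x - b) * evalPoly (quotient p b) x
  evalPoly-quotient (e ∷ []) b x = begin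
    e + x * 0#                   ≈⟨ x+y*0≈x e x ⟩
    e                            ≈⟨ x+y*0≈x e b ⟨
    e + b * 0#                   ≈⟨ x+y*0≈x _ (x - b) ⟨
    (e + b * 0#) + (x - b) * 0#  ∎
  evalPoly-quotient (e ∷ p@(_ ∷ _)) b x = begin
    e + x * evalPoly p x               ≈⟨ +-congˡ (*-congˡ (evalPoly-quotient p b x)) ⟩
    e + x * (A + d * B)                ≈⟨ +-congˡ (*-congʳ x≈d+b) ⟩
    e + (d + b) * (A + d * B)          ≈⟨ expand e d b A B ⟩
    (e + b * A) + d * (A + (d + b) * B) ≈⟨ +-congˡ (*-congˡ (+-congˡ (*-congʳ x≈d+b))) ⟨
    (e + b * A) + d * (A + x * B)      ∎
    where
      A = evalPoly p b
      B = evalPoly (quotient p b) x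
      d = x - b
      x≈d+b = sym (//-rightDividesˡ b x)
      expand : ∀ e d b A B → e + (d + b) * (A + d * B) ≈ (e + b * A) + d * (A + (d + b) * B)
      expand = solve 5 (λ e d b A B → e :+ (d :+ b) :* (A :+ d :* B) := (e :+ b :* A) :+ d :* (A :+ (d :+ b) :* B)) refl

  fromQuotRem : ∀ {m} → Carrier → Vec Carrier m → Carrier → Vec Carrier (suc m)
  fromQuotRem b []       e = e ∷ []
  fromQuotRem b (g ∷ gs) e = (e + - b * g) ∷ fromQuotRem b gs g

  evalPoly-fromQuotRem : ∀ {m} b (g : Vec Carrier m) e x →
    evalPoly (fromQuotRem b g e) x ≈ e + (x - b) * evalPoly g x
  evalPoly-fromQuotRem b [] e x = trans (x+y*0≈x e x) (sym (x+y*0≈x e (x - b)))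
  evalPoly-fromQuotRem b (g ∷ gs) e x =
    trans (+-congˡ (*-congˡ (evalPoly-fromQuotRem b gs g x))) (expand e (- b) g x (evalPoly gs x))
    where
      expand : ∀ e nb g x G → (e + nb * g) + x * (g + (x + nb) * G) ≈ e + (x + nb) * (g + x * G)
      expand = solve 5 (λ e nb g x G → (e :+ nb :* g) :+ x :* (g :+ (x :+ nb) :* G) := e :+ (x :+ nb) :* (g :+ x :* G)) refl

  evalPoly-zipWith-- : ∀ {m} (p q : Vec Carrier m) x →
    evalPoly (zipWith _-_ p q) x ≈ evalPoly p x - evalPoly q x
  evalPoly-zipWith-- []       []       x = sym (-‿inverseʳ 0#)
  evalPoly-zipWith-- (e ∷ p) (f ∷ q) x = begin
    (e - f) + x * evalPoly (zipWith _-_ p q) x  ≈⟨ +-congˡ (*-congˡ (evalPoly-zipWith-- p q x)) ⟩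
    (e - f) + x * (A - B)                      ≈⟨ rearrange e (- f) x A (- B) ⟩
    (e + x * A) + (- f + x * - B)              ≈⟨ +-congˡ (+-congˡ (-‿distribʳ-* x B)) ⟨
    (e + x * A) + (- f + - (x * B))            ≈⟨ +-congˡ (⁻¹-∙-comm f (x * B)) ⟩
    (e + x * A) - (f + x * B)                  ∎
    where
      A = evalPoly p x
      B = evalPoly q x
      rearrange : ∀ e nf x A nB → (e + nf) + x * (A + nB) ≈ (e + x * A) + (nf + x * nB)
      rearrange = solve 5 (λ e nf x A nB → (e :+ nf) :+ x :* (A :+ nB) := (e :+ x :* A) :+ (nf :+ x :* nB)) refl

  evalPoly-map-* : ∀ {m} s (p : Vec Carrier m) x → evalPoly (Vec.map (s *_) p) x ≈ s * evalPoly p x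
  evalPoly-map-* s []      x = sym (zeroʳ s)
  evalPoly-map-* s (e ∷ p) x =
    trans (+-congˡ (*-congˡ (evalPoly-map-* s p x))) (factor s e x (evalPoly p x))
    where
      factor : ∀ s e x E → s * e + x * (s * E) ≈ s * (e + x * E)
      factor = solve 4 (λ s e x E → s :* e :+ x :* (s :* E) := s :* (e :+ x :* E)) refl

  roots : ∀ {m} → Vec Carrier m → List Carrier → List Carrier
  roots p = filter (λ x → evalPoly p x ≟ 0#)

  roots-linearFactor : ∀ {m n} (p : Vec Carrier m) (q : Vec Carrier n) {b xs} →
    (∀ x → evalPoly p x ≈ (x - b) * evalPoly q x) → All (b ≉_) xs → roots p xs ≡ roots q xs
  roots-linearFactor p q p≈[x-b]q b∉xs =
    filter-≐-on _ _ (All.map (λ {x} b≉x →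
      ⇔-trans (≈0-cong (p≈[x-b]q x)) (x*y≈0⇔y≈0 (x-y≉0 (λ x≈b → b≉x (sym x≈b))))) b∉xs)

  length-roots≤ : ∀ m (p : Vec Carrier (suc m)) {b xs} → evalPoly p b ≉ 0# → Unique xs →
                  length (roots p xs) ≤ m
  length-roots≤ zero (e ∷ []) {b} {xs} pb≉0 _ =
    ≤-reflexive (≡.cong length (filter-none _ (All.universal constant≉0 xs)))
    where
      constant≉0 : ∀ x → evalPoly (e ∷ []) x ≉ 0#
      constant≉0 x px≈0 = pb≉0 (trans (x+y*0≈x e b) (trans (sym (x+y*0≈x e x)) px≈0))
  length-roots≤ (suc m) p {xs = []} _ _ = z≤n
  length-roots≤ (suc m) p {b} {x ∷ xs} pb≉0 (x≉xs ∷ unique-xs) with evalPoly p x ≟ 0#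
  ... | no  _    = length-roots≤ (suc m) p pb≉0 unique-xs
  ... | yes px≈0 = s≤s (≡.subst (_≤ m) (≡.sym (≡.cong length (roots-linearFactor p q p≈[y-x]q x≉xs)))
                         (length-roots≤ m q qb≉0 unique-xs))
    where
      q = quotient p x
      p≈[y-x]q : ∀ y → evalPoly p y ≈ (y - x) * evalPoly q y
      p≈[y-x]q y = trans (evalPoly-quotient p x y) (trans (+-congʳ px≈0) (+-identityˡ _))
      qb≉0 : evalPoly q b ≉ 0#
      qb≉0 qb≈0 = pb≉0 (trans (p≈[y-x]q b) (trans (*-congˡ qb≈0) (zeroʳ _)))

  vanishingPolynomial : ∀ k {b D} → k ≤ length D → Unique D → b ∉ D →
    Σ (Vec Carrier (suc k)) λ p → length (roots p D) ≡ k × evalPoly p b ≉ 0#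
  vanishingPolynomial zero {b} {D} _ _ _ =
    (1# ∷ []) , ≡.cong length (filter-none _ (All.universal one≉0 D)) , one≉0 b
    where
      one≉0 : ∀ x → evalPoly (1# ∷ []) x ≉ 0#
      one≉0 x one≈0 = 1≉0 (trans (sym (x+y*0≈x 1# x)) one≈0)
  vanishingPolynomial (suc k) {b} {d ∷ D} (s≤s k≤|D|) (d≉D ∷ unique-D) b∉d∷D =
    p , |roots-p|≡1+k , pb≉0
    where
      IH = vanishingPolynomial k k≤|D| unique-D (λ b∈D → b∉d∷D (there b∈D))
      p′ = proj₁ IH
      p = fromQuotRem d p′ 0#
      p≈[x-d]p′ : ∀ x → evalPoly p x ≈ (x - d) * evalPoly p′ x
      p≈[x-d]p′ x = trans (evalPoly-fromQuotRem d p′ 0# x) (+-identityˡ _)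
      pd≈0 : evalPoly p d ≈ 0#
      pd≈0 = trans (p≈[x-d]p′ d) (trans (*-congʳ (-‿inverseʳ d)) (zeroˡ _))
      |roots-p|≡1+k : length (roots p (d ∷ D)) ≡ suc k
      |roots-p|≡1+k = ≡.trans (≡.cong length (filter-accept (λ x → evalPoly p x ≟ 0#) {xs = D} pd≈0))
        (≡.cong suc (≡.trans (≡.cong length (roots-linearFactor p p′ p≈[x-d]p′ d≉D)) (proj₁ (proj₂ IH))))
      pb≉0 : evalPoly p b ≉ 0#
      pb≉0 pb≈0 = *-nonZero (x-y≉0 (λ b≈d → b∉d∷D (here b≈d))) (proj₂ (proj₂ IH))
                            (trans (sym (p≈[x-d]p′ b)) pb≈0)

  agreements : (Carrier → Carrier) → (Carrier → Carrier) → List Carrier → List Carrier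
  agreements g h = filter (λ x → g x ≟ h x)

  hamming+length-agreements : ∀ g h D →
    hamming (word g D) (word h D) ℕ.+ length (agreements g h D) ≡ length D
  hamming+length-agreements g h []       = ≡.refl
  hamming+length-agreements g h (x ∷ D) with g x ≟ h x
  ... | yes _ = ≡.trans (+-suc _ _) (≡.cong suc (hamming+length-agreements g h D))
  ... | no  _ = ≡.cong suc (hamming+length-agreements g h D)

  hamming≡length∸agreements : ∀ g h D →
    hamming (word g D) (word h D) ≡ length D ∸ length (agreements g h D)
  hamming≡length∸agreements g h D =
    ≡.trans (≡.sym (m+n∸n≡m _ (length (agreements g h D))))
            (≡.cong (_∸ length (agreements g h D)) (hamming+length-agreements g h D))

  deepHole-by-agreements : ∀ {k} D g →
    (∀ (f : Vec Carrier k) → length (agreements g (evalPoly f) D) ≤ k) →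
    (Σ (Vec Carrier k) λ f → length (agreements g (evalPoly f) D) ≡ k) →
    DeepHole D k (word g D)
  deepHole-by-agreements {k} D g agreements≤k (f , agreements≡k) =
      (f , ≡.trans (hamming≡length∸agreements g (evalPoly f) D) (≡.cong (length D ∸_) agreements≡k))
    , λ f′ → ≡.subst (length D ∸ k ≤_) (≡.sym (hamming≡length∸agreements g (evalPoly f′) D))
                     (∸-monoʳ-≤ (length D) (agreements≤k f′))

  evalPoly-fromQuotRem-at : ∀ {m} b (g : Vec Carrier m) e → evalPoly (fromQuotRem b g e) b ≈ e
  evalPoly-fromQuotRem-at b g e = begin
    evalPoly (fromQuotRem b g e) b  ≈⟨ evalPoly-fromQuotRem b g e b ⟩
    e + (b - b) * evalPoly g b      ≈⟨ +-congˡ (*-congʳ (-‿inverseʳ b)) ⟩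
    e + 0# * evalPoly g b           ≈⟨ +-congˡ (zeroˡ _) ⟩
    e + 0#                          ≈⟨ +-identityʳ e ⟩
    e                               ∎

  x-[x-y]≈y : ∀ x y → x - (x - y) ≈ y
  x-[x-y]≈y x y = begin
    x - (x - y)  ≈⟨ +-congˡ (⁻¹-anti-homo‿- x y) ⟩
    x + (y - x)  ≈⟨ +-comm x (y - x) ⟩
    (y - x) + x  ≈⟨ //-rightDividesˡ x y ⟩
    y            ∎

  inversePole : Carrier → Carrier → ∀ {k} → Vec Carrier k → Carrier → Carrier
  inversePole lam b r x = lam * pow (x - b) (order ∸ 2) + evalPoly r x

  inversePole≈⇔ : 2 ≤ order → ∀ {lam b x v k} (r : Vec Carrier k) → x ≉ b →
    (inversePole lam b r x ≈ v) ⇔ (lam + (x - b) * (evalPoly r x - v) ≈ 0#)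
  inversePole≈⇔ 2≤q {lam} {b} {x} {v} r x≉b =
    ⇔-trans ≈⇔-≈0 (⇔-trans (⇔-sym (x*y≈0⇔y≈0 (x-y≉0 x≉b))) (≈0-cong multiplied))
    where
      y = x - b
      w = pow y (order ∸ 2)
      multiplied : y * (inversePole lam b r x - v) ≈ lam + y * (evalPoly r x - v)
      multiplied = begin
        y * ((lam * w + evalPoly r x) - v)     ≈⟨ expand lam y w (evalPoly r x) (- v) ⟩
        lam * (y * w) + y * (evalPoly r x - v) ≈⟨ +-congʳ (*-congˡ (fermat 2≤q (x-y≉0 x≉b))) ⟩
        lam * 1# + y * (evalPoly r x - v)      ≈⟨ +-congʳ (*-identityʳ lam) ⟩
        lam + y * (evalPoly r x - v)           ∎
        where
          expand : ∀ l y w r nv → y * ((l * w + r) + nv) ≈ l * (y * w) + y * (r + nv)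
          expand = solve 5 (λ l y w r nv → y :* ((l :* w :+ r) :+ nv) := l :* (y :* w) :+ y :* (r :+ nv)) refl

  agreementPoly : Carrier → Carrier → ∀ {k} → Vec Carrier k → Vec Carrier k → Vec Carrier (suc k)
  agreementPoly lam b r f = fromQuotRem b (zipWith _-_ r f) lam

  evalPoly-agreementPoly : ∀ lam b {k} (r f : Vec Carrier k) x →
    evalPoly (agreementPoly lam b r f) x ≈ lam + (x - b) * (evalPoly r x - evalPoly f x)
  evalPoly-agreementPoly lam b r f x =
    trans (evalPoly-fromQuotRem b (zipWith _-_ r f) lam x) (+-congˡ (*-congˡ (evalPoly-zipWith-- r f x)))

  agreements-inversePole : 2 ≤ order → ∀ {lam b k} (r f : Vec Carrier k) {D} → b ∉ D →
    agreements (inversePole lam b r) (evalPoly f) D ≡ roots (agreementPoly lam b r f) D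
  agreements-inversePole 2≤q {lam} {b} r f b∉D =
    filter-≐-on _ _ (All.map (λ {x} b≉x →
      ⇔-trans (inversePole≈⇔ 2≤q r (λ x≈b → b≉x (sym x≈b)))
              (≈0-cong (sym (evalPoly-agreementPoly lam b r f x))))
      (∉⇒All[≉] setoid b∉D))

  inversePole-agreements≤ : 2 ≤ order → ∀ {lam b} → lam ≉ 0# → ∀ {k} (r f : Vec Carrier k) {D} →
    Unique D → b ∉ D → length (agreements (inversePole lam b r) (evalPoly f) D) ≤ k
  inversePole-agreements≤ 2≤q {lam} {b} lam≉0 {k} r f unique-D b∉D =
    ≡.subst (_≤ k) (≡.sym (≡.cong length (agreements-inversePole 2≤q r f b∉D)))
      (length-roots≤ k (agreementPoly lam b r f)
        (≉0-resp-≈ (sym (evalPoly-fromQuotRem-at b (zipWith _-_ r f) lam)) lam≉0) unique-D)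

  inversePole-agreements-attained : 2 ≤ order → ∀ {lam b} → lam ≉ 0# → ∀ {k} (r : Vec Carrier k) {D} →
    Unique D → b ∉ D → k ≤ length D →
    Σ (Vec Carrier k) λ f → length (agreements (inversePole lam b r) (evalPoly f) D) ≡ k
  inversePole-agreements-attained 2≤q {lam} {b} lam≉0 {k} r {D} unique-D b∉D k≤|D| =
    f , ≡.trans (≡.cong length (agreements-inversePole 2≤q r f b∉D))
          (≡.trans (≡.cong length (filter-≐-on _ _ (All.universal same-roots D))) |roots-p|≡k)
    where
      vanishing = vanishingPolynomial k k≤|D| unique-D b∉D
      p = proj₁ vanishing
      |roots-p|≡k = proj₁ (proj₂ vanishing)
      ratio = ∃-ratio (proj₂ (proj₂ vanishing)) lam≉0
      s = proj₁ ratio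
      sp = Vec.map (s *_) p
      q = quotient sp b
      f = zipWith _-_ r q
      agreementPoly≈sp : ∀ x → evalPoly (agreementPoly lam b r f) x ≈ s * evalPoly p x
      agreementPoly≈sp x = begin
        evalPoly (agreementPoly lam b r f) x           ≈⟨ evalPoly-agreementPoly lam b r f x ⟩
        lam + (x - b) * (evalPoly r x - evalPoly f x)  ≈⟨ +-congˡ (*-congˡ r-f≈q) ⟩
        lam + (x - b) * evalPoly q x                   ≈⟨ +-congʳ spb≈lam ⟨
        evalPoly sp b + (x - b) * evalPoly q x         ≈⟨ evalPoly-quotient sp b x ⟨
        evalPoly sp x                                  ≈⟨ evalPoly-map-* s p x ⟩
        s * evalPoly p x                               ∎
        where
          spb≈lam = trans (evalPoly-map-* s p b) (proj₂ (proj₂ ratio))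
          r-f≈q : evalPoly r x - evalPoly f x ≈ evalPoly q x
          r-f≈q = trans (+-congˡ (-‿cong (evalPoly-zipWith-- r q x)))
                        (x-[x-y]≈y (evalPoly r x) (evalPoly q x))
      same-roots : ∀ x → (evalPoly (agreementPoly lam b r f) x ≈ 0#) ⇔ (evalPoly p x ≈ 0#)
      same-roots x = ⇔-trans (≈0-cong (agreementPoly≈sp x)) (x*y≈0⇔y≈0 (proj₁ (proj₂ ratio)))

  deepHole-inversePole : 2 ≤ order → ∀ {lam b} → lam ≉ 0# → ∀ {k} (r : Vec Carrier k) {D} →
    Unique D → b ∉ D → k ≤ length D → DeepHole D k (word (inversePole lam b r) D)
  deepHole-inversePole 2≤q {lam} {b} lam≉0 r {D} unique-D b∉D k≤|D| =
    deepHole-by-agreements D (inversePole lam b r)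
      (λ f → inversePole-agreements≤ 2≤q lam≉0 r f unique-D b∉D)
      (inversePole-agreements-attained 2≤q lam≉0 r unique-D b∉D k≤|D|)

  module _ {l} (a : Fin l → Carrier) where

    private
      Hit : Carrier → Set ℓ
      Hit x = ∃ λ i → x ≈ a i

      hit? : Decidable Hit
      hit? x = FinP.any? (λ i → x ≟ a i)

      hit-resp : ∀ {x y} → x ≈ y → Hit x → Hit y
      hit-resp x≈y (i , x≈ai) = i , trans (sym x≈y) x≈ai

    evalSet-unique : Unique (evalSet a)
    evalSet-unique = AllPairs.filter⁺ _ distinct

    ∉-evalSet : ∀ j → a j ∉ evalSet a
    ∉-evalSet j aj∈ = proj₂ (∈-filter⁻ setoid (∁? hit?) ¬hit-resp {xs = elems} aj∈) (j , refl)
      where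
        ¬hit-resp : ∀ {x y} → x ≈ y → ¬ Hit x → ¬ Hit y
        ¬hit-resp x≈y ¬hx hy = ¬hx (hit-resp (sym x≈y) hy)

    order∸l≤length-evalSet : order ∸ l ≤ length (evalSet a)
    order∸l≤length-evalSet = ≡.subst (order ∸ l ≤_) |evalSet|≡ (∸-monoʳ-≤ order |hits|≤l)
      where
        hits = filter hit? elems
        hits⊆a : ∀ {x} → x ∈ hits → x ∈ tabulate a
        hits⊆a x∈ with ∈-filter⁻ setoid hit? hit-resp {xs = elems} x∈
        ... | _ , i , x≈ai = ∈-resp-≈ setoid (sym x≈ai) (∈-tabulate⁺ setoid i)
        |hits|≤l : length hits ≤ l
        |hits|≤l = ≡.subst (length hits ≤_) (length-tabulate a)
                     (unique-⊆⇒length≤ setoid (AllPairs.filter⁺ hit? distinct) hits⊆a)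
        |evalSet|≡ : order ∸ length hits ≡ length (evalSet a)
        |evalSet|≡ = ≡.trans (≡.cong (_∸ length hits) (≡.sym (length-filter+length-filter-∁ hit? elems)))
                             (m+n∸m≡n (length hits) _)

theorem1p2 : ∀ {c ℓ : Level} (R : CommutativeRing c ℓ) (F : IsFiniteField R)
    → let open CommutativeRing R
          open IsFiniteField F
          open FieldDefs R F
          q = order
      in IsPrimePower q → 4 ≤ q
      → (l : ℕ) → 1 ≤ l
      → (a : Fin l → Carrier) → (∀ i j → ¬ (i ≡ j) → ¬ (a i ≈ a j))
      → (k : ℕ) → 2 ≤ k → k ≤ q ∸ l ∸ 1
      → (lam : Fin l → Carrier) → (∀ j → ¬ (lam j ≈ 0#))
      → (r : Fin l → Vec Carrier k)
      → ∀ (j : Fin l) →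
          DeepHole (evalSet a) k
            (word (λ x → lam j * pow (x - a j) (q ∸ 2) + evalPoly (r j) x) (evalSet a))
theorem1p2 R F _ 4≤q l _ a _ k _ k≤q∸l∸1 lam lam≉0 r j =
  deepHole-inversePole (≤-trans (s≤s (s≤s z≤n)) 4≤q) (lam≉0 j) (r j)
    (evalSet-unique a) (∉-evalSet a j)
    (≤-trans k≤q∸l∸1 (≤-trans (m∸n≤m _ 1) (order∸l≤length-evalSet a)))
  where open FiniteField R F
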